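{- The value $\operatorname{cdes}(w^{ -1})$ depends only on the left coset $wC\in W/C$: for all $w\in W$ and $c\in C$, $\operatorname{cdes}((wc)^{ -1})=\operatorname{cdes}(w^{ -1})$.
   Context: Root system data. - $\Phi$ is an irreducible crystallographic root system with simple roots $\alpha_1,\dots,\alpha_r$ and positive roots $\Phi^+$. Write $\alpha<0$ if $-\alpha\in\Phi^+$. - $W$ is the Weyl group and $\Lambda^\vee$ the coweight lattice. - $\omega_i$ are the fundamental coweights and $\rho=\sum\omega_i$. - $\theta$ is the highest root; set $\alpha_0=-\theta$, $a_0=1$, $a_i=(\omega_i,\theta)$, and $h^\vee=\sum_{i=0}^ra_i$. Definitions. - $C=\{w\in W:w(\rho)-\rho\in h^\vee\Lambda^\vee\}$, a subgroup of $W$. - $d_i(w)=1$ if $w(\alpha_i)<0$ and $0$ otherwise ($0\le i\le r$). - $\operatorname{cdes}(w)=\sum_{i=0}^ra_id_i(w)$. -}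

module Defs where

open import Data.Nat using (ℕ; zero; suc)
open import Data.Fin using (Fin; zero; suc)
open import Data.Fin.Properties using (all?)
open import Data.Integer using (ℤ; +_; _+_; _-_; _*_; -_; _≤_; _<_; _≤?_)
open import Data.Integer.Divisibility using (_∣_)
open import Data.Bool using (Bool; true; false; if_then_else_)
open import Data.List using (List; []; _∷_)
open import Data.Product using (Σ; ∃; _×_; _,_)
open import Relation.Nullary using (¬_)
open import Relation.Nullary.Decidable using (⌊_⌋)
open import Relation.Binary.PropositionalEquality using (_≡_)

sumFin : (r : ℕ) → (Fin r → ℤ) → ℤ
sumFin zero    f = + 0
sumFin (suc r) f = f zero + sumFin r (λ i → f (suc i))

-- A root system of rank r is given by its Cartan matrix
--   A i j = ⟨α_i^∨ , α_j⟩   (Kac's convention).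
-- Roots live in the root lattice, written in simple-root coordinates:
-- v : Fin r → ℤ stands for Σ_j v j · α_j.
-- Coweights live in the coweight lattice Λ^∨, written in
-- fundamental-coweight coordinates: λ : Fin r → ℤ stands for Σ_j λ j · ω_j,
-- so that (ω_i , α_j) = δ_ij and α_i^∨ = Σ_j A i j · ω_j.

CartanMatrix : ℕ → Set
CartanMatrix r = Fin r → Fin r → ℤ

IsGCM : {r : ℕ} → CartanMatrix r → Set
IsGCM {r} A =
  (∀ i → A i i ≡ + 2) ×
  (∀ i j → ¬ (i ≡ j) → A i j ≤ + 0) ×
  (∀ i j → A i j ≡ + 0 → A j i ≡ + 0)

IsIndecomposable : {r : ℕ} → CartanMatrix r → Set
IsIndecomposable {r} A =
  (S : Fin r → Bool) →
  (∀ i j → S i ≡ true → S j ≡ false → A i j ≡ + 0) →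
  (∀ i j → S i ≡ S j)

-- Positive definiteness over ℚ is
-- equivalent to positive definiteness on nonzero integer vectors (clear
-- denominators), which is what we state.
IsFiniteType : {r : ℕ} → CartanMatrix r → Set
IsFiniteType {r} A =
  Σ (Fin r → ℕ) λ d →
    (∀ i → ¬ (d i ≡ 0)) ×
    (∀ i j → (+ d i) * A i j ≡ (+ d j) * A j i) ×
    (∀ (x : Fin r → ℤ) → ¬ (∀ i → x i ≡ + 0) →
       + 0 < sumFin r (λ i → sumFin r (λ j → x i * ((+ d i) * A i j) * x j)))

IsIrreducibleRootSystem : {r : ℕ} → CartanMatrix r → Set
IsIrreducibleRootSystem A = IsGCM A × IsIndecomposable A × IsFiniteType A

-- Weyl group: elements are represented by words in the simple reflections.
-- The word i₁ ∷ … ∷ i_k ∷ [] represents s_{i₁} ⋯ s_{i_k}; concatenation is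
-- the group product and reversal is inversion.

Word : ℕ → Set
Word r = List (Fin r)

_≟F_ : {r : ℕ} → Fin r → Fin r → Bool
zero  ≟F zero  = true
zero  ≟F suc _ = false
suc _ ≟F zero  = false
suc i ≟F suc j = i ≟F j

simpleRoot : {r : ℕ} → Fin r → Fin r → ℤ
simpleRoot i j = if i ≟F j then + 1 else + 0

-- s_i(v) = v - ⟨α_i^∨ , v⟩ α_i  on the root lattice.
reflRoot : {r : ℕ} → CartanMatrix r → Fin r → (Fin r → ℤ) → (Fin r → ℤ)
reflRoot {r} A i v j = v j - sumFin r (λ k → A i k * v k) * simpleRoot i j

actRoot : {r : ℕ} → CartanMatrix r → Word r → (Fin r → ℤ) → (Fin r → ℤ)
actRoot A []      v = v
actRoot A (i ∷ w) v = reflRoot A i (actRoot A w v)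

-- s_i(λ) = λ - (λ , α_i) α_i^∨  on the coweight lattice.
reflCoweight : {r : ℕ} → CartanMatrix r → Fin r → (Fin r → ℤ) → (Fin r → ℤ)
reflCoweight A i λ′ j = λ′ j - λ′ i * A i j

actCoweight : {r : ℕ} → CartanMatrix r → Word r → (Fin r → ℤ) → (Fin r → ℤ)
actCoweight A []      λ′ = λ′
actCoweight A (i ∷ w) λ′ = reflCoweight A i (actCoweight A w λ′)

IsRoot : {r : ℕ} → CartanMatrix r → (Fin r → ℤ) → Set
IsRoot {r} A v = Σ (Word r) λ w → Σ (Fin r) λ i → ∀ j → v j ≡ actRoot A w (simpleRoot i) j

IsHighestRoot : {r : ℕ} → CartanMatrix r → (Fin r → ℤ) → Set
IsHighestRoot A θ = IsRoot A θ × (∀ β → IsRoot A β → ∀ j → β j ≤ θ j)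

-- For a root α, α < 0 (i.e. -α ∈ Φ⁺) iff all its simple-root coefficients
-- are ≤ 0.  Only applied to roots below.
isNegative : {r : ℕ} → (Fin r → ℤ) → Bool
isNegative v = ⌊ all? (λ j → v j ≤? + 0) ⌋

-- Affine data: α₀ = -θ, a₀ = 1, a_i = (ω_i , θ) = θ i, h^∨ = Σ_{i=0}^r a_i

hvee : {r : ℕ} → (Fin r → ℤ) → ℤ
hvee {r} θ = + 1 + sumFin r θ

ρ : {r : ℕ} → Fin r → ℤ
ρ _ = + 1

InC : {r : ℕ} → CartanMatrix r → (Fin r → ℤ) → Word r → Set
InC A θ w = ∀ j → hvee θ ∣ (actCoweight A w ρ j - ρ j)

bit : Bool → ℤ
bit true  = + 1
bit false = + 0

d₀ : {r : ℕ} → CartanMatrix r → (Fin r → ℤ) → Word r → ℤ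
d₀ A θ w = bit (isNegative (actRoot A w (λ j → - θ j)))

d : {r : ℕ} → CartanMatrix r → Word r → Fin r → ℤ
d A w i = bit (isNegative (actRoot A w (simpleRoot i)))

cdes : {r : ℕ} → CartanMatrix r → (Fin r → ℤ) → Word r → ℤ
cdes {r} A θ w = + 1 * d₀ A θ w + sumFin r (λ i → θ i * d A w i)

module Submission where

-- Put t = Σ_j θ_j = h^∨ - 1 and, for a root β,
--     R(β) = h^∨ · [β < 0] + ht(β),      ht(β) = Σ_j β_j = ⟨ρ, β⟩.
-- Since every root is either positive or negative and -t ≤ ht(β) ≤ t
-- (θ is highest), R(β) always lies in {1, …, t}.  If c ∈ C then
-- ht(c⁻¹β) - ht(β) = ⟨c ρ - ρ, β⟩ is divisible by h^∨, hence
-- R(c⁻¹β) ≡ R(β) mod h^∨, and as both lie in {1,…,t}, R(c⁻¹β) = R(β).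
-- Finally Σ_{i=0}^r a_i α_i = 0 gives  h^∨ · cdes(x) = Σ_i a_i R(x α_i),
-- so cdes(c⁻¹ w⁻¹) = cdes(w⁻¹).

open import Defs
open import Data.Nat using (ℕ)
open import Data.Fin using (Fin)
open import Data.Integer using (ℤ)
open import Data.List using (_++_; reverse)
open import Relation.Binary.PropositionalEquality using (_≡_)

open import Data.Nat as N using (zero; suc)
import Data.Nat.Properties as NP
open import Data.Fin as F using (zero; suc)
open import Data.Fin.Properties as FP using (all?)
open import Data.Integer as Z using (+_; -[1+_]; _+_; _-_; _*_; -_; _≤_; _<_; +≤+; -≤-)
import Data.Integer.Properties as ZP
open import Data.Integer.Divisibility.Signed as DS using (divides)
open import Data.Integer.Tactic.RingSolver using (solve-∀)
open import Data.Bool using (Bool; true; false; not; T; _∧_)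
open import Data.List using (List; []; _∷_; length; map)
import Data.List.Properties as LP
open import Data.List.Reverse using (Reverse; []; _∶_∶ʳ_; reverseView)
open import Data.List.Relation.Unary.All using (All; []; _∷_)
import Data.List.Relation.Unary.All.Properties as AllP
open import Data.Product using (Σ; _×_; _,_; proj₁; proj₂)
open import Data.Sum using (_⊎_; inj₁; inj₂)
open import Data.Empty using (⊥; ⊥-elim)
open import Data.Unit using (tt)
open import Relation.Nullary using (¬_; yes; no)
open import Relation.Nullary.Negation using (¬¬-Monad)
open import Relation.Nullary.Decidable using (¬¬-excluded-middle; decidable-stable; _×-dec_; isYes≗does; dec-true; dec-false)
open import Effect.Monad using (RawMonad)
open import Level using (0ℓ)
open import Data.Nat.Induction using (<-rec)
open import Relation.Binary.PropositionalEquality using (refl; sym; trans; cong; cong₂; subst; subst₂; module ≡-Reasoning)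

sum-cong : ∀ {r} {f g : Fin r → ℤ} → (∀ i → f i ≡ g i) → sumFin r f ≡ sumFin r g
sum-cong {zero}  e = refl
sum-cong {suc r} e = cong₂ _+_ (e zero) (sum-cong (λ i → e (suc i)))

sum-+ : ∀ {r} (f g : Fin r → ℤ) → sumFin r (λ i → f i + g i) ≡ sumFin r f + sumFin r g
sum-+ {zero}  f g = refl
sum-+ {suc r} f g =
  trans (cong (_+_ (f zero + g zero)) (sum-+ (λ i → f (suc i)) (λ i → g (suc i))))
        (interchange (f zero) (g zero) _ _)
  where
  interchange : ∀ a b c d → a + b + (c + d) ≡ a + c + (b + d)
  interchange = solve-∀

sum-*ˡ : ∀ {r} c (f : Fin r → ℤ) → sumFin r (λ i → c * f i) ≡ c * sumFin r f
sum-*ˡ {zero}  c f = sym (ZP.*-zeroʳ c)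
sum-*ˡ {suc r} c f = trans (cong (_+_ (c * f zero)) (sum-*ˡ c (λ i → f (suc i))))
                           (sym (ZP.*-distribˡ-+ c _ _))

sum-neg : ∀ {r} (f : Fin r → ℤ) → sumFin r (λ i → - f i) ≡ - sumFin r f
sum-neg {zero}  f = refl
sum-neg {suc r} f = trans (cong (_+_ (- f zero)) (sum-neg (λ i → f (suc i))))
                          (sym (ZP.neg-distrib-+ (f zero) _))

sum-- : ∀ {r} (f g : Fin r → ℤ) → sumFin r (λ i → f i - g i) ≡ sumFin r f - sumFin r g
sum-- f g = trans (sum-+ f (λ i → - g i)) (cong (_+_ (sumFin _ f)) (sum-neg g))

sum-0 : ∀ r → sumFin r (λ _ → + 0) ≡ + 0
sum-0 zero    = refl
sum-0 (suc r) = trans (ZP.+-identityˡ _) (sum-0 r)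

sum-mono : ∀ {r} {f g : Fin r → ℤ} → (∀ i → f i ≤ g i) → sumFin r f ≤ sumFin r g
sum-mono {zero}  le = +≤+ N.z≤n
sum-mono {suc r} le = ZP.+-mono-≤ (le zero) (sum-mono (λ i → le (suc i)))

sum-nonneg : ∀ {r} {f : Fin r → ℤ} → (∀ i → + 0 ≤ f i) → + 0 ≤ sumFin r f
sum-nonneg {r} {f} nn = subst (_≤ sumFin r f) (sum-0 r) (sum-mono nn)

sum-pos : ∀ {r} {f : Fin r → ℤ} → (∀ i → + 0 ≤ f i) → ∀ j → + 0 < f j → + 0 < sumFin r f
sum-pos {suc r} nn zero    p = ZP.+-mono-<-≤ p (sum-nonneg (λ i → nn (suc i)))
sum-pos {suc r} nn (suc j) p = ZP.+-mono-≤-< (nn zero) (sum-pos (λ i → nn (suc i)) j p)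

sum-∣ : ∀ {r} {h : ℤ} {f : Fin r → ℤ} → (∀ i → h DS.∣ f i) → h DS.∣ sumFin r f
sum-∣ {zero}  {h} dv = divides (+ 0) (sym (ZP.*-zeroˡ h))
sum-∣ {suc r}     dv = DS.∣m∣n⇒∣m+n (dv zero) (sum-∣ (λ i → dv (suc i)))

≟F-refl : ∀ {r} (i : Fin r) → (i ≟F i) ≡ true
≟F-refl zero    = refl
≟F-refl (suc i) = ≟F-refl i

≟F-≢ : ∀ {r} {i j : Fin r} → ¬ i ≡ j → (i ≟F j) ≡ false
≟F-≢ {i = zero}  {zero}  i≢j = ⊥-elim (i≢j refl)
≟F-≢ {i = zero}  {suc j} i≢j = refl
≟F-≢ {i = suc i} {zero}  i≢j = refl
≟F-≢ {i = suc i} {suc j} i≢j = ≟F-≢ (λ e → i≢j (cong suc e))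

δ-diag : ∀ {r} (i : Fin r) → simpleRoot i i ≡ + 1
δ-diag i rewrite ≟F-refl i = refl

δ-off : ∀ {r} {i j : Fin r} → ¬ i ≡ j → simpleRoot i j ≡ + 0
δ-off i≢j rewrite ≟F-≢ i≢j = refl

δ-nonneg : ∀ {r} (i j : Fin r) → + 0 ≤ simpleRoot i j
δ-nonneg i j with i ≟F j
... | true  = +≤+ N.z≤n
... | false = +≤+ N.z≤n

sum-δ : ∀ {r} (i : Fin r) (f : Fin r → ℤ) → sumFin r (λ k → f k * simpleRoot i k) ≡ f i
sum-δ {suc r} zero f =
  trans (cong₂ _+_ (ZP.*-identityʳ (f zero))
                   (trans (sum-cong (λ k → ZP.*-zeroʳ (f (suc k)))) (sum-0 r)))
        (ZP.+-identityʳ (f zero))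
sum-δ {suc r} (suc i) f =
  trans (cong₂ _+_ (ZP.*-zeroʳ (f zero)) (sum-δ i (λ k → f (suc k))))
        (ZP.+-identityˡ (f (suc i)))

Vector : ℕ → Set
Vector r = Fin r → ℤ

infix  4 _≈_
infixl 6 _⊕_
infixl 7 _⊙_

-- Pointwise equality; functions are not extensional in Agda.
_≈_ : ∀ {r} → Vector r → Vector r → Set
u ≈ v = ∀ j → u j ≡ v j

_⊕_ : ∀ {r} → Vector r → Vector r → Vector r
(u ⊕ v) j = u j + v j

_⊙_ : ∀ {r} → ℤ → Vector r → Vector r
(t ⊙ u) j = t * u j

neg : ∀ {r} → Vector r → Vector r
neg u j = - u j

0v : ∀ {r} → Vector r
0v _ = + 0

≈-refl : ∀ {r} {u : Vector r} → u ≈ u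
≈-refl j = refl

≈-sym : ∀ {r} {u v : Vector r} → u ≈ v → v ≈ u
≈-sym e j = sym (e j)

≈-trans : ∀ {r} {u v w : Vector r} → u ≈ v → v ≈ w → u ≈ w
≈-trans e f j = trans (e j) (f j)

Nonneg Nonpos : ∀ {r} → Vector r → Set
Nonneg v = ∀ j → + 0 ≤ v j
Nonpos v = ∀ j → v j ≤ + 0

*-nonneg : ∀ {a b : ℤ} → + 0 ≤ a → + 0 ≤ b → + 0 ≤ a * b
*-nonneg {+ m} {+ n} _ _ = subst (+ 0 ≤_) (ZP.pos-* m n) (+≤+ N.z≤n)

Nonneg-≈ : ∀ {r} {u v : Vector r} → u ≈ v → Nonneg v → Nonneg u
Nonneg-≈ e nv j = subst (+ 0 ≤_) (sym (e j)) (nv j)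

Nonneg-comb : ∀ {r} {u v : Vector r} {P Q : ℤ} → Nonneg u → Nonneg v →
              + 0 ≤ P → + 0 ≤ Q → Nonneg (P ⊙ u ⊕ Q ⊙ v)
Nonneg-comb nu nv p q j = ZP.+-mono-≤ (*-nonneg p (nu j)) (*-nonneg q (nv j))

module Reflections {r : ℕ} (A : CartanMatrix r) where

  -- The coroot pairing ⟨α_i^∨ , v⟩; by definition
  -- reflRoot A i v j = v j - coroot i v * δ_ij.
  coroot : Fin r → Vector r → ℤ
  coroot i v = sumFin r (λ k → A i k * v k)

  coroot-cong : ∀ i {u v} → u ≈ v → coroot i u ≡ coroot i v
  coroot-cong i e = sum-cong (λ k → cong (A i k *_) (e k))

  coroot-⊕ : ∀ i u v → coroot i (u ⊕ v) ≡ coroot i u + coroot i v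
  coroot-⊕ i u v = trans (sum-cong (λ k → ZP.*-distribˡ-+ (A i k) (u k) (v k)))
                         (sum-+ (λ k → A i k * u k) (λ k → A i k * v k))

  coroot-⊙ : ∀ i t u → coroot i (t ⊙ u) ≡ t * coroot i u
  coroot-⊙ i t u = trans (sum-cong (λ k → swap (A i k) t (u k))) (sum-*ˡ t (λ k → A i k * u k))
    where
    swap : ∀ a b c → a * (b * c) ≡ b * (a * c)
    swap = solve-∀

  coroot-δ : ∀ i l → coroot i (simpleRoot l) ≡ A i l
  coroot-δ i l = sum-δ l (A i)

  coroot-neg : ∀ i u → coroot i (neg u) ≡ - coroot i u
  coroot-neg i u = trans (sum-cong (λ k → sym (ZP.neg-distribʳ-* (A i k) (u k))))
                         (sum-neg (λ k → A i k * u k))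

  coroot-shift : ∀ i l v t → coroot i (v ⊕ t ⊙ simpleRoot l) ≡ coroot i v + t * A i l
  coroot-shift i l v t =
    trans (coroot-⊕ i v _) (cong (_+_ (coroot i v)) (trans (coroot-⊙ i t _) (cong (t *_) (coroot-δ i l))))

  refl-shift : ∀ i v → reflRoot A i v ≈ v ⊕ (- coroot i v) ⊙ simpleRoot i
  refl-shift i v j = minus-as-plus (v j) (coroot i v) (simpleRoot i j)
    where
    minus-as-plus : ∀ a x d → a - x * d ≡ a + - x * d
    minus-as-plus = solve-∀

  refl-cong : ∀ i {u v} → u ≈ v → reflRoot A i u ≈ reflRoot A i v
  refl-cong i e j = cong₂ _-_ (e j) (cong (_* simpleRoot i j) (coroot-cong i e))

  refl-⊕ : ∀ i u v → reflRoot A i (u ⊕ v) ≈ reflRoot A i u ⊕ reflRoot A i v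
  refl-⊕ i u v j rewrite coroot-⊕ i u v = distrib (u j) (v j) (coroot i u) (coroot i v) (simpleRoot i j)
    where
    distrib : ∀ a b x y d → a + b - (x + y) * d ≡ a - x * d + (b - y * d)
    distrib = solve-∀

  refl-⊙ : ∀ i t u → reflRoot A i (t ⊙ u) ≈ t ⊙ reflRoot A i u
  refl-⊙ i t u j rewrite coroot-⊙ i t u = distrib t (u j) (coroot i u) (simpleRoot i j)
    where
    distrib : ∀ t a x d → t * a - t * x * d ≡ t * (a - x * d)
    distrib = solve-∀

  refl-neg : ∀ i u → reflRoot A i (neg u) ≈ neg (reflRoot A i u)
  refl-neg i u j rewrite coroot-neg i u = distrib (u j) (coroot i u) (simpleRoot i j)
    where
    distrib : ∀ a x d → - a - - x * d ≡ - (a - x * d)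
    distrib = solve-∀

  act-cong : ∀ w {u v} → u ≈ v → actRoot A w u ≈ actRoot A w v
  act-cong []      e = e
  act-cong (i ∷ w) e = refl-cong i (act-cong w e)

  act-++ : ∀ x y v → actRoot A (x ++ y) v ≡ actRoot A x (actRoot A y v)
  act-++ []      y v = refl
  act-++ (i ∷ x) y v = cong (reflRoot A i) (act-++ x y v)

  act-++≈ : ∀ x y v → actRoot A (x ++ y) v ≈ actRoot A x (actRoot A y v)
  act-++≈ x y v j = cong (λ f → f j) (act-++ x y v)

  act-⊕ : ∀ w u v → actRoot A w (u ⊕ v) ≈ actRoot A w u ⊕ actRoot A w v
  act-⊕ []      u v = ≈-refl
  act-⊕ (i ∷ w) u v = ≈-trans (refl-cong i (act-⊕ w u v)) (refl-⊕ i (actRoot A w u) (actRoot A w v))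

  act-⊙ : ∀ w t u → actRoot A w (t ⊙ u) ≈ t ⊙ actRoot A w u
  act-⊙ []      t u = ≈-refl
  act-⊙ (i ∷ w) t u = ≈-trans (refl-cong i (act-⊙ w t u)) (refl-⊙ i t (actRoot A w u))

  act-neg : ∀ w u → actRoot A w (neg u) ≈ neg (actRoot A w u)
  act-neg []      u = ≈-refl
  act-neg (i ∷ w) u = ≈-trans (refl-cong i (act-neg w u)) (refl-neg i (actRoot A w u))

  act-0 : ∀ w → actRoot A w 0v ≈ 0v
  act-0 w = ≈-trans (act-cong w (λ j → sym (ZP.*-zeroˡ (+ 0))))
                    (≈-trans (act-⊙ w (+ 0) 0v) (λ j → ZP.*-zeroˡ (actRoot A w 0v j)))

  module _ (A-diag : ∀ i → A i i ≡ + 2) where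

    coroot-refl : ∀ i v → coroot i (reflRoot A i v) ≡ - coroot i v
    coroot-refl i v =
      trans (coroot-cong i (refl-shift i v))
     (trans (coroot-shift i i v (- coroot i v))
     (trans (cong (λ a → coroot i v + - coroot i v * a) (A-diag i)) (cancel (coroot i v))))
      where
      cancel : ∀ x → x + - x * + 2 ≡ - x
      cancel = solve-∀

    refl-invol : ∀ i v → reflRoot A i (reflRoot A i v) ≈ v
    refl-invol i v j rewrite coroot-refl i v = cancel (v j) (coroot i v) (simpleRoot i j)
      where
      cancel : ∀ a x d → a - x * d - - x * d ≡ a
      cancel = solve-∀

    refl-simple : ∀ i → reflRoot A i (simpleRoot i) ≈ neg (simpleRoot i)
    refl-simple i j =
      trans (cong (λ a → simpleRoot i j - a * simpleRoot i j) (trans (coroot-δ i i) (A-diag i)))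
            (cancel (simpleRoot i j))
      where
      cancel : ∀ d → d - + 2 * d ≡ - d
      cancel = solve-∀

    act-snoc-simple : ∀ x k → actRoot A (x ++ k ∷ []) (simpleRoot k) ≈ neg (actRoot A x (simpleRoot k))
    act-snoc-simple x k = ≈-trans (act-++≈ x (k ∷ []) (simpleRoot k))
                                  (≈-trans (act-cong x (refl-simple k)) (act-neg x (simpleRoot k)))

-- Existence of reduced
-- words and of minimal counterexamples is only available classically;
-- all final conclusions are decidable, so the ¬¬ is eventually removed
-- with decidable-stable.

open RawMonad (¬¬-Monad {a = 0ℓ}) using (pure; _>>=_)

Least : (ℕ → Set) → ℕ → Set
Least P m = P m × (∀ k → k N.< m → ¬ P k)

least : (P : ℕ → Set) → ∀ n → P n → ¬ ¬ (Σ ℕ (Least P))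
least P = <-rec (λ n → P n → ¬ ¬ (Σ ℕ (Least P))) step
  where
  step : ∀ n → (∀ {m} → m N.< n → P m → ¬ ¬ (Σ ℕ (Least P))) → P n → ¬ ¬ (Σ ℕ (Least P))
  step n smaller pn = ¬¬-excluded-middle {A = Σ ℕ λ k → k N.< n × P k} >>= λ where
    (yes (k , k<n , pk)) → smaller k<n pk
    (no none)            → pure (n , pn , λ k k<n pk → none (k , k<n , pk))

++-shorter-suffix : ∀ {X : Set} (p Z Z′ : List X) →
  length (p ++ Z) N.≤ length (p ++ Z′) → length Z′ N.< length Z → ⊥
++-shorter-suffix p Z Z′ le lt =
  NP.<⇒≱ lt (NP.+-cancelˡ-≤ (length p) _ _ (subst₂ N._≤_ (LP.length-++ p) (LP.length-++ p) le))

-- Words.  Two words represent the same element of W exactly when they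
-- act in the same way on the root lattice; lengths are compared among
-- representatives of the same element.

module Words {r : ℕ} (A : CartanMatrix r) (A-diag : ∀ i → A i i ≡ + 2) where
  open Reflections A

  -- Equality in W.  A record (rather than a bare Π-type) keeps the two
  -- words visible to type inference.
  infix 4 _~_
  record _~_ (x y : Word r) : Set where
    constructor mk~
    field same-action : ∀ v → actRoot A x v ≈ actRoot A y v
  open _~_ public

  ~-refl : ∀ {x} → x ~ x
  ~-refl = mk~ λ v → ≈-refl

  ~-sym : ∀ {x y} → x ~ y → y ~ x
  ~-sym e = mk~ λ v → ≈-sym (same-action e v)

  ~-trans : ∀ {x y z} → x ~ y → y ~ z → x ~ z
  ~-trans e f = mk~ λ v → ≈-trans (same-action e v) (same-action f v)

  ~-reflexive : ∀ {x y} → x ≡ y → x ~ y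
  ~-reflexive refl = ~-refl

  ~-++ˡ : ∀ z {x y} → x ~ y → z ++ x ~ z ++ y
  ~-++ˡ z {x} {y} e = mk~ λ v →
    ≈-trans (act-++≈ z x v) (≈-trans (act-cong z (same-action e v)) (≈-sym (act-++≈ z y v)))

  ~-++ʳ : ∀ z {x y} → x ~ y → x ++ z ~ y ++ z
  ~-++ʳ z {x} {y} e = mk~ λ v →
    ≈-trans (act-++≈ x z v) (≈-trans (same-action e (actRoot A z v)) (≈-sym (act-++≈ y z v)))

  cancel-pair : ∀ p t q → p ++ t ∷ t ∷ q ~ p ++ q
  cancel-pair p t q = ~-++ˡ p (mk~ λ v → refl-invol A-diag t (actRoot A q v))

  cancel-last : ∀ x t → (x ++ t ∷ []) ++ t ∷ [] ~ x
  cancel-last x t = ~-trans (~-reflexive (LP.++-assoc x (t ∷ []) (t ∷ [])))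
                            (~-trans (cancel-pair x t []) (~-reflexive (LP.++-identityʳ x)))

  LengthAtLeast : ℕ → Word r → Set
  LengthAtLeast n u = ∀ z → z ~ u → n N.≤ length z

  shorter-word : ∀ {n u} → ¬ LengthAtLeast n u → ¬ ¬ (Σ (Word r) λ z → z ~ u × length z N.< n)
  shorter-word ¬long no-shorter = ¬long λ z z~u → NP.≮⇒≥ λ z<n → no-shorter (z , z~u , z<n)

  Reduced : Word r → Set
  Reduced x = LengthAtLeast (length x) x

  reduced-word : ∀ u → ¬ ¬ (Σ (Word r) λ x → x ~ u × Reduced x)
  reduced-word u =
    least (λ m → Σ (Word r) λ x → length x ≡ m × x ~ u) (length u) (u , refl , ~-refl) >>= λ where
      (_ , (x , refl , x~u) , shortest) → pure (x , x~u , λ z z~x →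
        NP.≮⇒≥ λ z<x → shortest (length z) z<x (z , refl , ~-trans z~x x~u))

  suffix-minimal : ∀ {n u} (v y y′ : Word r) → LengthAtLeast n u → v ++ y′ ~ u →
                   length v N.+ length y ≡ n → LengthAtLeast (length y) y′
  suffix-minimal v y y′ ℓu vy′~u len z z~y′ =
    NP.+-cancelˡ-≤ (length v) (length y) (length z)
      (subst₂ N._≤_ (sym len) (LP.length-++ v) (ℓu (v ++ z) (~-trans (~-++ˡ v z~y′) vy′~u)))

  prefix-minimal : ∀ {n u} (v v′ y : Word r) → LengthAtLeast n u → v′ ++ y ~ u →
                   length v N.+ length y ≡ n → LengthAtLeast (length v) v′
  prefix-minimal v v′ y ℓu v′y~u len z z~v′ =
    NP.+-cancelʳ-≤ (length y) (length v) (length z)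
      (subst₂ N._≤_ (sym len) (LP.length-++ z) (ℓu (z ++ y) (~-trans (~-++ʳ y z~v′) v′y~u)))

-- Fix s ≠ s' with a = a_ss', b = a_s's.  A
-- vector u = v + P α_s + Q α_s' is tracked, relative to a base vector v,
-- by the plane state (⟨α_s^∨,u⟩, ⟨α_s'^∨,u⟩, P, Q).  Simple reflections
-- act on plane states by explicit formulas (letter true is s, false s'),
-- so relations between words in s, s' become closed computations.

PlaneState : Set
PlaneState = ℤ × ℤ × ℤ × ℤ

reflectState : ℤ → ℤ → Bool → PlaneState → PlaneState
reflectState a b true  (X , Y , P , Q) = (- X , Y - X * b , P - X , Q)
reflectState a b false (X , Y , P , Q) = (X - Y * a , - Y , P , Q - Y)

runState : ℤ → ℤ → List Bool → PlaneState → PlaneState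
runState a b []       st = st
runState a b (t ∷ ts) st = reflectState a b t (runState a b ts st)

combine : ℤ → PlaneState → ℤ → PlaneState → PlaneState
combine x (e₁ , e₂ , e₃ , e₄) y (f₁ , f₂ , f₃ , f₄) =
  (x * e₁ + y * f₁ , x * e₂ + y * f₂ , x * e₃ + y * f₃ , x * e₄ + y * f₄)

reflectState-linear : ∀ a b t x e y f →
  reflectState a b t (combine x e y f) ≡ combine x (reflectState a b t e) y (reflectState a b t f)
reflectState-linear a b true x (e₁ , e₂ , e₃ , e₄) y (f₁ , f₂ , f₃ , f₄) =
  cong₂ _,_ (neg-lin x e₁ y f₁)
            (cong₂ _,_ (sub-lin x e₁ e₂ y f₁ f₂ b) (cong₂ _,_ (diff-lin x e₁ e₃ y f₁ f₃) refl))
  where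
  neg-lin : ∀ x e y f → - (x * e + y * f) ≡ x * - e + y * - f
  neg-lin = solve-∀
  sub-lin : ∀ x e₁ e₂ y f₁ f₂ b → x * e₂ + y * f₂ - (x * e₁ + y * f₁) * b ≡ x * (e₂ - e₁ * b) + y * (f₂ - f₁ * b)
  sub-lin = solve-∀
  diff-lin : ∀ x e₁ e₃ y f₁ f₃ → x * e₃ + y * f₃ - (x * e₁ + y * f₁) ≡ x * (e₃ - e₁) + y * (f₃ - f₁)
  diff-lin = solve-∀
reflectState-linear a b false x (e₁ , e₂ , e₃ , e₄) y (f₁ , f₂ , f₃ , f₄) =
  cong₂ _,_ (sub-lin x e₂ e₁ y f₂ f₁ a)
            (cong₂ _,_ (neg-lin x e₂ y f₂) (cong₂ _,_ refl (diff-lin x e₂ e₄ y f₂ f₄)))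
  where
  neg-lin : ∀ x e y f → - (x * e + y * f) ≡ x * - e + y * - f
  neg-lin = solve-∀
  sub-lin : ∀ x e₁ e₂ y f₁ f₂ b → x * e₂ + y * f₂ - (x * e₁ + y * f₁) * b ≡ x * (e₂ - e₁ * b) + y * (f₂ - f₁ * b)
  sub-lin = solve-∀
  diff-lin : ∀ x e₁ e₃ y f₁ f₃ → x * e₃ + y * f₃ - (x * e₁ + y * f₁) ≡ x * (e₃ - e₁) + y * (f₃ - f₁)
  diff-lin = solve-∀

runState-linear : ∀ a b ts x e y f →
  runState a b ts (combine x e y f) ≡ combine x (runState a b ts e) y (runState a b ts f)
runState-linear a b []       x e y f = refl
runState-linear a b (t ∷ ts) x e y f =
  trans (cong (reflectState a b t) (runState-linear a b ts x e y f)) (reflectState-linear a b t x _ y _)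

basis₁ basis₂ : PlaneState
basis₁ = (+ 1 , + 0 , + 0 , + 0)
basis₂ = (+ 0 , + 1 , + 0 , + 0)

plane-expand : ∀ X Y → (X , Y , + 0 , + 0) ≡ combine X basis₁ Y basis₂
plane-expand X Y = cong₂ _,_ (first X Y) (cong₂ _,_ (second X Y) (cong₂ _,_ (rest X Y) (rest X Y)))
  where
  first : ∀ X Y → X ≡ X * + 1 + Y * + 0
  first = solve-∀
  second : ∀ X Y → Y ≡ X * + 0 + Y * + 1
  second = solve-∀
  rest : ∀ X Y → + 0 ≡ X * + 0 + Y * + 0
  rest = solve-∀

runState-basis : ∀ a b ts ts′ →
  runState a b ts basis₁ ≡ runState a b ts′ basis₁ →
  runState a b ts basis₂ ≡ runState a b ts′ basis₂ →
  ∀ X Y → runState a b ts (X , Y , + 0 , + 0) ≡ runState a b ts′ (X , Y , + 0 , + 0)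
runState-basis a b ts ts′ agree₁ agree₂ X Y
  rewrite plane-expand X Y | runState-linear a b ts X basis₁ Y basis₂
        | runState-linear a b ts′ X basis₁ Y basis₂ | agree₁ | agree₂ = refl

-- The alternating letter sequence of length k ending in false (= s'),
-- read right to left: letter j is the (j+1)-st letter from the right.
letter : ℕ → Bool
letter zero    = false
letter (suc j) = not (letter j)

alternating : ℕ → List Bool
alternating zero    = []
alternating (suc k) = letter k ∷ alternating k

length-alternating : ∀ k → length (alternating k) ≡ k
length-alternating zero    = refl
length-alternating (suc k) = cong suc (length-alternating k)

-- The coordinates P, Q of (alternating k) · α_s, computed from the plane
-- state (2, b, 1, 0) of α_s relative to the base vector 0.
coefficients : ℤ → ℤ → ℕ → ℤ × ℤ
coefficients a b k with runState a b (alternating k) (+ 2 , b , + 1 , + 0)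
... | (_ , _ , P , Q) = P , Q

isNonneg : ℤ → Bool
isNonneg (+ _)    = true
isNonneg -[1+ _ ] = false

isNonneg-sound : ∀ z → T (isNonneg z) → + 0 ≤ z
isNonneg-sound (+ n) _ = +≤+ N.z≤n

allNonneg : ℤ → ℤ → ℕ → Bool
allNonneg a b zero    = true
allNonneg a b (suc k) = isNonneg (proj₁ (coefficients a b k)) ∧ isNonneg (proj₂ (coefficients a b k))
                        ∧ allNonneg a b k

allNonneg-sound : ∀ a b m → T (allNonneg a b m) → ∀ k → k N.< m →
  + 0 ≤ proj₁ (coefficients a b k) × + 0 ≤ proj₂ (coefficients a b k)
allNonneg-sound a b (suc m) check k k<1+m
  with isNonneg (proj₁ (coefficients a b m)) in e₁ | isNonneg (proj₂ (coefficients a b m)) in e₂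
... | true | true with k N.≟ m
...   | yes refl = isNonneg-sound _ (subst T (sym e₁) tt) , isNonneg-sound _ (subst T (sym e₂) tt)
...   | no k≢m   = allNonneg-sound a b m check k (NP.≤∧≢⇒< (NP.≤-pred k<1+m) k≢m)

module Dihedral {r : ℕ} (A : CartanMatrix r) (A-diag : ∀ i → A i i ≡ + 2)
                (s s′ : Fin r) where
  open Reflections A
  open Words A A-diag

  tag : Bool → Fin r
  tag true  = s
  tag false = s′

  αs αs′ : Vector r
  αs  = simpleRoot s
  αs′ = simpleRoot s′

  Describes : Vector r → PlaneState → Vector r → Set
  Describes v (X , Y , P , Q) u = (u ≈ v ⊕ P ⊙ αs ⊕ Q ⊙ αs′) × X ≡ coroot s u × Y ≡ coroot s′ u

  module _ (a b : ℤ) (a≡ : A s s′ ≡ a) (b≡ : A s′ s ≡ b) where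

    describes-reflect : ∀ t v st u → Describes v st u →
                        Describes v (reflectState a b t st) (reflRoot A (tag t) u)
    describes-reflect true v (X , Y , P , Q) u (u≈ , refl , refl) =
      (λ j → trans (refl-shift s u j) (trans (cong (λ z → z + - X * αs j) (u≈ j))
                                             (regroup (v j) P Q X (αs j) (αs′ j)))) ,
      sym (coroot-refl A-diag s u) ,
      sym (trans (coroot-cong s′ (refl-shift s u))
          (trans (coroot-shift s′ s u (- X)) (trans (cong (λ z → Y + - X * z) b≡) (minus Y X b))))
      where
      regroup : ∀ v P Q X d d′ → v + P * d + Q * d′ + - X * d ≡ v + (P - X) * d + Q * d′
      regroup = solve-∀
      minus : ∀ Y X b → Y + - X * b ≡ Y - X * b
      minus = solve-∀
    describes-reflect false v (X , Y , P , Q) u (u≈ , refl , refl) =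
      (λ j → trans (refl-shift s′ u j) (trans (cong (λ z → z + - Y * αs′ j) (u≈ j))
                                              (regroup (v j) P Q Y (αs j) (αs′ j)))) ,
      sym (trans (coroot-cong s (refl-shift s′ u))
          (trans (coroot-shift s s′ u (- Y)) (trans (cong (λ z → X + - Y * z) a≡) (minus X Y a)))) ,
      sym (coroot-refl A-diag s′ u)
      where
      regroup : ∀ v P Q Y d d′ → v + P * d + Q * d′ + - Y * d′ ≡ v + P * d + (Q - Y) * d′
      regroup = solve-∀
      minus : ∀ Y X b → Y + - X * b ≡ Y - X * b
      minus = solve-∀

    describes-run : ∀ ts v st u → Describes v st u →
                    Describes v (runState a b ts st) (actRoot A (map tag ts) u)
    describes-run []       v st u d = d
    describes-run (t ∷ ts) v st u d = describes-reflect t v (runState a b ts st) _ (describes-run ts v st u d)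

    describes-self : ∀ v → Describes v (coroot s v , coroot s′ v , + 0 , + 0) v
    describes-self v = (λ j → pad (v j) (αs j) (αs′ j)) , refl , refl
      where
      pad : ∀ v d d′ → v ≡ v + + 0 * d + + 0 * d′
      pad = solve-∀

    relation-from-states : ∀ ts ts′ →
      runState a b ts basis₁ ≡ runState a b ts′ basis₁ →
      runState a b ts basis₂ ≡ runState a b ts′ basis₂ →
      map tag ts ~ map tag ts′
    relation-from-states ts ts′ agree₁ agree₂ = mk~ λ v →
      same-state v (describes-run ts v _ v (describes-self v)) (describes-run ts′ v _ v (describes-self v))
                   (runState-basis a b ts ts′ agree₁ agree₂ (coroot s v) (coroot s′ v))
      where
      same-state : ∀ v {u u′ st st′} → Describes v st u → Describes v st′ u′ → st ≡ st′ → u ≈ u′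
      same-state v {st = _ , _ , _ , _} (u≈ , _) (u′≈ , _) refl = ≈-trans u≈ (≈-sym u′≈)

    describes-αs : Describes 0v (+ 2 , b , + 1 , + 0) αs
    describes-αs = (λ j → pad (αs j) (αs′ j)) ,
                   sym (trans (coroot-δ s s) (A-diag s)) , sym (trans (coroot-δ s′ s) b≡)
      where
      pad : ∀ d d′ → d ≡ + 0 + + 1 * d + + 0 * d′
      pad = solve-∀

    alternating-αs : ∀ k → actRoot A (map tag (alternating k)) αs ≈
                           proj₁ (coefficients a b k) ⊙ αs ⊕ proj₂ (coefficients a b k) ⊙ αs′
    alternating-αs k = read (runState a b (alternating k) (+ 2 , b , + 1 , + 0))
                            (describes-run (alternating k) 0v _ αs describes-αs)
      where
      read : ∀ st {u} → Describes 0v st u → u ≈ proj₁ (proj₂ (proj₂ st)) ⊙ αs ⊕ proj₂ (proj₂ (proj₂ st)) ⊙ αs′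
      read (X , Y , P , Q) (u≈ , _) j = trans (u≈ j) (cong (_+ Q * αs′ j) (ZP.+-identityˡ (P * αs j)))

  alt : ℕ → Word r
  alt k = map tag (alternating k)

  length-alt : ∀ k → length (alt k) ≡ k
  length-alt k = trans (LP.length-map tag (alternating k)) (length-alternating k)

  NonnegInPlane : Word r → Set
  NonnegInPlane y = Σ ℤ λ P → Σ ℤ λ Q → + 0 ≤ P × + 0 ≤ Q × (actRoot A y αs ≈ P ⊙ αs ⊕ Q ⊙ αs′)

  -- The dihedral group is finite of order 2(half+1): the braid relation
  -- (alt (half+1)) s = alt half holds, and the shorter alternating words
  -- send α_s to nonnegative combinations of α_s, α_s'.
  record DihedralData : Set where
    field
      half     : ℕ
      braid    : alt (suc half) ++ s ∷ [] ~ alt half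
      positive : ∀ k → k N.≤ half → NonnegInPlane (alt k)

  InPair : Fin r → Set
  InPair t = t ≡ s ⊎ t ≡ s′

  other-letter : ∀ {x} c → InPair x → ¬ x ≡ tag (not c) → x ≡ tag c
  other-letter true  (inj₁ x≡s)  _     = x≡s
  other-letter true  (inj₂ x≡s′) x≢s′  = ⊥-elim (x≢s′ x≡s′)
  other-letter false (inj₁ x≡s)  x≢s   = ⊥-elim (x≢s x≡s)
  other-letter false (inj₂ x≡s′) _     = x≡s′

  -- Reading y from
  -- the right it must be alternating and end in s' (a repeated letter
  -- or a final s would shorten y or y s), and it cannot reach length
  -- half+1 because of the braid relation.
  module DihedralLemma (D : DihedralData) (y : Word r) (y-in-pair : All InPair y)
                       (y-reduced : Reduced y) (ys-long : LengthAtLeast (length y) (y ++ s ∷ [])) where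
    open DihedralData D

    no-full-braid : ∀ p → ¬ y ≡ p ++ alt (suc half)
    no-full-braid p y≡ =
      ++-shorter-suffix p (alt (suc half)) (alt half)
        (subst (λ z → length z N.≤ length (p ++ alt half)) y≡ (ys-long _ p-alt~ys))
        (subst₂ N._<_ (sym (length-alt half)) (sym (length-alt (suc half))) NP.≤-refl)
      where
      p-alt~ys : p ++ alt half ~ y ++ s ∷ []
      p-alt~ys = ~-sym (~-trans (~-reflexive (trans (cong (_++ s ∷ []) y≡) (LP.++-assoc p (alt (suc half)) (s ∷ []))))
                                (~-++ˡ p braid))

    wrong-letter : ∀ p x j → y ≡ (p ++ x ∷ []) ++ alt j → InPair x → ¬ x ≡ tag (letter j) → ⊥
    wrong-letter p x zero y≡ x-in x≢s′ with other-letter true x-in x≢s′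
    ... | refl = ++-shorter-suffix p (x ∷ []) []
                   (subst (λ z → length z N.≤ length (p ++ [])) y≡′ (ys-long _ p~ys)) (N.s≤s N.z≤n)
      where
      y≡′ : y ≡ p ++ s ∷ []
      y≡′ = trans y≡ (LP.++-identityʳ _)
      p~ys : p ++ [] ~ y ++ s ∷ []
      p~ys = ~-trans (~-reflexive (LP.++-identityʳ p))
                     (~-sym (subst (λ z → z ++ s ∷ [] ~ p) (sym y≡′) (cancel-last p s)))
    wrong-letter p x (suc j) y≡ x-in x≢ with other-letter (letter j) x-in x≢
    ... | refl = ++-shorter-suffix p (x ∷ x ∷ alt j) (alt j)
                   (subst (λ z → length z N.≤ length (p ++ alt j)) y≡′
                          (y-reduced _ (~-sym (~-trans (~-reflexive y≡′) (cancel-pair p x (alt j))))))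
                   (N.s≤s (NP.n≤1+n _))
      where
      y≡′ : y ≡ p ++ x ∷ x ∷ alt j
      y≡′ = trans y≡ (LP.++-assoc p (x ∷ []) _)

    last-in-pair : ∀ p x j → y ≡ (p ++ x ∷ []) ++ alt j → InPair x
    last-in-pair p x j y≡ with AllP.++⁻ʳ p (AllP.++⁻ˡ (p ++ x ∷ []) (subst (All InPair) y≡ y-in-pair))
    ... | x-in ∷ [] = x-in

    -- Invariant: y = p · alt j with j ≤ half + 1; p is consumed from the right.
    scan : ∀ {p} → Reverse p → ∀ j → j N.≤ suc half → y ≡ p ++ alt j →
           Σ ℕ λ k → k N.≤ half × y ≡ alt k
    extend : ∀ {p} → Reverse p → ∀ j → j N.≤ half → y ≡ p ++ alt j →
             Σ ℕ λ k → k N.≤ half × y ≡ alt k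

    scan {p} rp j j≤ y≡ with j N.≟ suc half
    ... | yes refl = ⊥-elim (no-full-braid p y≡)
    ... | no j≢    = extend rp j (NP.≤-pred (NP.≤∧≢⇒< j≤ j≢)) y≡

    extend [] j j≤ y≡ = j , j≤ , y≡
    extend (p ∶ rp ∶ʳ x) j j≤ y≡ with x F.≟ tag (letter j)
    ... | yes refl = scan rp (suc j) (N.s≤s j≤) (trans y≡ (LP.++-assoc p (x ∷ []) (alt j)))
    ... | no x≢    = ⊥-elim (wrong-letter p x j y≡ (last-in-pair p x j y≡) x≢)

    dihedral-lemma : NonnegInPlane y
    dihedral-lemma with scan (reverseView y) 0 N.z≤n (sym (LP.++-identityʳ y))
    ... | k , k≤ , refl = positive k k≤

-- Finite type: the only rank-two subsystems are A₁×A₁, A₂, B₂ and G₂.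

too-large : ∀ p q {m n} → p N.≤ m → q N.≤ n → 4 N.≤ p N.* q → ¬ m N.* n N.< 4
too-large p q p≤m q≤n 4≤pq mn<4 = NP.<⇒≱ mn<4 (NP.≤-trans 4≤pq (NP.*-mono-≤ p≤m q≤n))

-- Arithmetic core of the bound a_ss' a_s's < 4.  Write α = -a_ss',
-- β = -a_s's.  Symmetrizability gives D α = D' β, and positivity of the
-- quadratic form at α α_s + 2 α_s' gives Q = 8 D' - 2 D α² > 0.  Then
-- β Q = 2 D α (4 - α β), so α β < 4.
product<4 : ∀ (D D′ n k : ℕ) → + D * + suc n ≡ + D′ * + suc k → ¬ D ≡ 0 →
            + 0 < + 8 * + D′ - + 2 * + D * (+ suc n * + suc n) → suc n N.* suc k N.< 4
product<4 zero    D′ n k _    D≢0 _   = ⊥-elim (D≢0 refl)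
product<4 (suc D) D′ n k symm _   Q>0 =
  ZP.drop‿+<+ (subst (_< + 4) (sym (ZP.pos-* (suc n) (suc k))) αβ<4)
  where
  open ≡-Reasoning
  α β Q : ℤ
  α = + suc n
  β = + suc k
  Q = + 8 * + D′ - + 2 * + suc D * (α * α)

  βQ≡ : β * Q ≡ + 2 * + suc D * α * (+ 4 - α * β)
  βQ≡ = begin
    β * Q                                              ≡⟨ expand β (+ D′) (+ suc D) α ⟩
    + 8 * (+ D′ * β) - + 2 * + suc D * (α * α) * β     ≡⟨ cong (λ z → + 8 * z - + 2 * + suc D * (α * α) * β) (sym symm) ⟩
    + 8 * (+ suc D * α) - + 2 * + suc D * (α * α) * β  ≡⟨ factor (+ suc D) α β ⟩
    + 2 * + suc D * α * (+ 4 - α * β)                  ∎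
    where
    expand : ∀ β D′ D α → β * (+ 8 * D′ - + 2 * D * (α * α)) ≡ + 8 * (D′ * β) - + 2 * D * (α * α) * β
    expand = solve-∀
    factor : ∀ D α β → + 8 * (D * α) - + 2 * D * (α * α) * β ≡ + 2 * D * α * (+ 4 - α * β)
    factor = solve-∀

  -- β Q > 0, and 2 D α is a positive integer.
  4-αβ>0 : + 0 < + 4 - α * β
  4-αβ>0 = ZP.*-cancelˡ-<-nonNeg (+ 2 * + suc D * α)
    (subst₂ _<_ (trans (ZP.*-zeroʳ β) (sym (ZP.*-zeroʳ (+ 2 * + suc D * α)))) βQ≡ (ZP.*-monoˡ-<-pos β Q>0))

  αβ<4 : α * β < + 4
  αβ<4 = subst₂ _<_ (ZP.+-identityʳ (α * β)) (add-back (α * β)) (ZP.+-monoʳ-< (α * β) 4-αβ>0)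
    where
    add-back : ∀ x → x + (+ 4 - x) ≡ + 4
    add-back = solve-∀

module FiniteType {r : ℕ} (A : CartanMatrix r) (gcm : IsGCM A) (ft : IsFiniteType A) where

  A-diag : ∀ i → A i i ≡ + 2
  A-diag = proj₁ gcm

  off-diag-nonpos : ∀ i j → ¬ i ≡ j → A i j ≤ + 0
  off-diag-nonpos = proj₁ (proj₂ gcm)

  zero-symmetric : ∀ i j → A i j ≡ + 0 → A j i ≡ + 0
  zero-symmetric = proj₂ (proj₂ gcm)

  open Words A A-diag

  weight : Fin r → ℕ
  weight = proj₁ ft

  M : Fin r → Fin r → ℤ
  M i j = + weight i * A i j

  weight≢0 : ∀ i → ¬ weight i ≡ 0
  weight≢0 = proj₁ (proj₂ ft)

  M-symmetric : ∀ i j → M i j ≡ M j i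
  M-symmetric = proj₁ (proj₂ (proj₂ ft))

  positive-definite : ∀ x → ¬ (∀ i → x i ≡ + 0) → + 0 < sumFin r (λ i → sumFin r (λ j → x i * M i j * x j))
  positive-definite = proj₂ (proj₂ (proj₂ ft))

  module _ (s s′ : Fin r) (s≢s′ : ¬ s ≡ s′) where

    sum-plane : ∀ (F : Fin r → ℤ) p q →
      sumFin r (λ j → F j * (p ⊙ simpleRoot s ⊕ q ⊙ simpleRoot s′) j) ≡ F s * p + F s′ * q
    sum-plane F p q =
      trans (sum-cong (λ j → distrib (F j) p q (simpleRoot s j) (simpleRoot s′ j)))
     (trans (sum-+ (λ j → F j * p * simpleRoot s j) (λ j → F j * q * simpleRoot s′ j))
            (cong₂ _+_ (sum-δ s (λ j → F j * p)) (sum-δ s′ (λ j → F j * q))))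
      where
      distrib : ∀ F p q δ δ′ → F * (p * δ + q * δ′) ≡ F * p * δ + F * q * δ′
      distrib = solve-∀

    form-on-plane : ∀ p q →
      let x = p ⊙ simpleRoot s ⊕ q ⊙ simpleRoot s′ in
      sumFin r (λ i → sumFin r (λ j → x i * M i j * x j))
        ≡ (M s s * p + M s s′ * q) * p + (M s′ s * p + M s′ s′ * q) * q
    form-on-plane p q =
      trans (sum-cong (λ i → trans (sum-plane (λ j → x i * M i j) p q) (regroup (x i) (M i s) (M i s′) p q)))
            (sum-plane (λ i → M i s * p + M i s′ * q) p q)
      where
      x : Vector r
      x = p ⊙ simpleRoot s ⊕ q ⊙ simpleRoot s′
      regroup : ∀ x a b p q → x * a * p + x * b * q ≡ (a * p + b * q) * x
      regroup = solve-∀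

    plane-nonzero : ∀ p → ¬ (∀ i → (p ⊙ simpleRoot s ⊕ + 2 ⊙ simpleRoot s′) i ≡ + 0)
    plane-nonzero p all-zero with all-zero s′
    ... | at-s′ rewrite δ-off s≢s′ | δ-diag s′ | ZP.*-zeroʳ p with at-s′
    ... | ()

    cartan-product<4 : ∀ n k → A s s′ ≡ -[1+ n ] → A s′ s ≡ -[1+ k ] → suc n N.* suc k N.< 4
    cartan-product<4 n k a≡ b≡ = product<4 (weight s) (weight s′) n k symm (weight≢0 s) Q>0
      where
      α : ℤ
      α = + suc n
      symm : + weight s * α ≡ + weight s′ * + suc k
      symm = ZP.neg-injective (begin
        - (+ weight s * α)           ≡⟨ ZP.neg-distribʳ-* (+ weight s) α ⟩
        + weight s * -[1+ n ]        ≡⟨ cong (+ weight s *_) (sym a≡) ⟩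
        M s s′                       ≡⟨ M-symmetric s s′ ⟩
        M s′ s                       ≡⟨ cong (+ weight s′ *_) b≡ ⟩
        + weight s′ * -[1+ k ]       ≡⟨ ZP.neg-distribʳ-* (+ weight s′) (+ suc k) ⟨
        - (+ weight s′ * + suc k)    ∎)
        where open ≡-Reasoning
      M≡ : (M s s * α + M s s′ * + 2) * α + (M s′ s * α + M s′ s′ * + 2) * + 2
           ≡ + 8 * + weight s′ - + 2 * + weight s * (α * α)
      M≡ rewrite sym (M-symmetric s s′) | A-diag s | A-diag s′ | a≡ = evaluate (+ weight s) (+ weight s′) α
        where
        evaluate : ∀ D D′ α → (D * + 2 * α + D * - α * + 2) * α + (D * - α * α + D′ * + 2 * + 2) * + 2
                              ≡ + 8 * D′ - + 2 * D * (α * α)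
        evaluate = solve-∀
      Q>0 : + 0 < + 8 * + weight s′ - + 2 * + weight s * (α * α)
      Q>0 = subst (+ 0 <_) (trans (form-on-plane α (+ 2)) M≡) (positive-definite _ (plane-nonzero α))

    open Dihedral A A-diag s s′

    -- Dihedral data from a closed computation: the braid relation and the
    -- signs of the coefficients are checked by evaluation.
    from-computation : (a b : ℤ) → A s s′ ≡ a → A s′ s ≡ b → (half : ℕ) →
      runState a b (alternating (suc half) ++ true ∷ []) basis₁ ≡ runState a b (alternating half) basis₁ →
      runState a b (alternating (suc half) ++ true ∷ []) basis₂ ≡ runState a b (alternating half) basis₂ →
      T (allNonneg a b (suc half)) → DihedralData
    from-computation a b a≡ b≡ half agree₁ agree₂ check = record
      { half     = half
      ; braid    = ~-trans (~-reflexive (sym (LP.map-++ tag (alternating (suc half)) (true ∷ []))))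
                           (relation-from-states a b a≡ b≡ _ _ agree₁ agree₂)
      ; positive = λ k k≤half → let signs = allNonneg-sound a b (suc half) check k (N.s≤s k≤half) in
          proj₁ (coefficients a b k) , proj₂ (coefficients a b k) , proj₁ signs , proj₂ signs ,
          alternating-αs a b a≡ b≡ k
      }

    -- The pairs with a_ss' a_s's < 4: types A₂ (half 2), B₂ (3), G₂ (5).
    from-product : ∀ n k → A s s′ ≡ -[1+ n ] → A s′ s ≡ -[1+ k ] → suc n N.* suc k N.< 4 → DihedralData
    from-product 0 0 a≡ b≡ _ = from-computation _ _ a≡ b≡ 2 refl refl tt
    from-product 0 1 a≡ b≡ _ = from-computation _ _ a≡ b≡ 3 refl refl tt
    from-product 1 0 a≡ b≡ _ = from-computation _ _ a≡ b≡ 3 refl refl tt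
    from-product 0 2 a≡ b≡ _ = from-computation _ _ a≡ b≡ 5 refl refl tt
    from-product 2 0 a≡ b≡ _ = from-computation _ _ a≡ b≡ 5 refl refl tt
    from-product 0 (suc (suc (suc k))) _ _ lt = ⊥-elim (too-large 1 4 NP.≤-refl (NP.m≤m+n 4 k) NP.≤-refl lt)
    from-product 1 (suc k) _ _ lt = ⊥-elim (too-large 2 2 NP.≤-refl (NP.m≤m+n 2 k) NP.≤-refl lt)
    from-product 2 (suc k) _ _ lt = ⊥-elim (too-large 3 2 NP.≤-refl (NP.m≤m+n 2 k) (NP.m≤m+n 4 2) lt)
    from-product (suc (suc (suc n))) k _ _ lt = ⊥-elim (too-large 4 1 (NP.m≤m+n 4 n) (N.s≤s N.z≤n) NP.≤-refl lt)

    not-positive : ∀ {z k} → z ≤ + 0 → ¬ z ≡ + suc k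
    not-positive (+≤+ ()) refl

    -- Every pair of distinct simple reflections generates a finite
    -- dihedral group; the A₁ × A₁ case is a_ss' = a_s's = 0 (half 1).
    dihedral-data : DihedralData
    dihedral-data with A s s′ in a≡ | A s′ s in b≡
    ... | + suc n  | _        = ⊥-elim (not-positive (off-diag-nonpos s s′ s≢s′) a≡)
    ... | _        | + suc k  = ⊥-elim (not-positive (off-diag-nonpos s′ s (λ e → s≢s′ (sym e))) b≡)
    ... | + 0      | + 0      = from-computation _ _ a≡ b≡ 1 refl refl tt
    ... | + 0      | -[1+ k ] with () ← trans (sym b≡) (zero-symmetric s s′ a≡)
    ... | -[1+ n ] | + 0      with () ← trans (sym a≡) (zero-symmetric s′ s b≡)
    ... | -[1+ n ] | -[1+ k ] = from-product n k a≡ b≡ (cartan-product<4 n k a≡ b≡)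

module Positivity {r : ℕ} (A : CartanMatrix r) (A-diag : ∀ i → A i i ≡ + 2)
                  (dihedral : ∀ s s′ → ¬ s ≡ s′ → Dihedral.DihedralData A A-diag s s′) where
  open Reflections A
  open Words A A-diag

  PositiveAt : ℕ → Set
  PositiveAt n = ∀ w → length w ≡ n → Reduced w → ∀ s →
                 LengthAtLeast n (w ++ s ∷ []) → ¬ ¬ Nonneg (actRoot A w (simpleRoot s))

  -- Among all factorisations
  -- w = v · y of length n with y a word in s, s', pick one with v
  -- shortest.  Then v and y are reduced, ℓ(y s) ≥ ℓ(y), and ℓ(v t) ≥ ℓ(v)
  -- for t = s, s' (else t could be moved into y).  So v α_s, v α_s' ≥ 0
  -- by induction, y α_s = P α_s + Q α_s' with P, Q ≥ 0 by the dihedral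
  -- lemma, and w α_s = P v α_s + Q v α_s' ≥ 0.
  module Step (n : ℕ) (ih : ∀ {m} → m N.< n → PositiveAt m) (w′ : Word r) (s′ s : Fin r)
              (s′≢s : ¬ s′ ≡ s) (len : length (w′ ++ s′ ∷ []) ≡ n)
              (reduced : Reduced (w′ ++ s′ ∷ []))
              (ws-long : LengthAtLeast n ((w′ ++ s′ ∷ []) ++ s ∷ [])) where
    open Dihedral A A-diag s s′ using (InPair; module DihedralLemma)

    w : Word r
    w = w′ ++ s′ ∷ []

    w-long : LengthAtLeast n w
    w-long = subst (λ k → LengthAtLeast k w) len reduced

    length-w′ : length w′ N.+ 1 ≡ n
    length-w′ = trans (sym (LP.length-++ w′)) len

    Factorisation : ℕ → Set
    Factorisation m = Σ (Word r) λ v → Σ (Word r) λ y →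
      length v ≡ m × All InPair y × v ++ y ~ w × length v N.+ length y ≡ n

    trivial : Factorisation (length w′)
    trivial = w′ , s′ ∷ [] , refl , inj₂ refl ∷ [] , ~-refl , length-w′

    module Shortest (v y : Word r) (y-in-pair : All InPair y) (vy~w : v ++ y ~ w)
                    (lengths : length v N.+ length y ≡ n)
                    (shortest : ∀ k → k N.< length v → ¬ Factorisation k) where

      v-short : length v N.< n
      v-short = NP.≤-<-trans (NP.≮⇒≥ λ w′<v → shortest (length w′) w′<v trivial)
                             (subst (length w′ N.<_) (trans (NP.+-comm 1 (length w′)) length-w′) NP.≤-refl)

      v-reduced : Reduced v
      v-reduced = prefix-minimal v v y w-long vy~w lengths

      y-reduced : Reduced y
      y-reduced = suffix-minimal v y y w-long vy~w lengths

      ys-long : LengthAtLeast (length y) (y ++ s ∷ [])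
      ys-long = suffix-minimal v y (y ++ s ∷ []) ws-long
                  (~-trans (~-reflexive (sym (LP.++-assoc v y (s ∷ [])))) (~-++ʳ (s ∷ []) vy~w)) lengths

      -- If ℓ(v t) < ℓ(v), then x ~ v t shorter than v gives the shorter
      -- factorisation w = x · (t y).
      vt-long : ∀ t → InPair t → LengthAtLeast (length v) (v ++ t ∷ [])
      vt-long t t-in x x~vt = NP.≮⇒≥ λ x<v →
        shortest (length x) x<v (x , t ∷ y , refl , t-in ∷ y-in-pair , xty~w , NP.≤-antisym (shorter x<v) longer)
        where
        xty~w : x ++ t ∷ y ~ w
        xty~w = ~-trans (~-++ʳ (t ∷ y) x~vt)
               (~-trans (~-reflexive (LP.++-assoc v (t ∷ []) (t ∷ y))) (~-trans (cancel-pair v t y) vy~w))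
        shorter : length x N.< length v → length x N.+ suc (length y) N.≤ n
        shorter x<v = subst (length x N.+ suc (length y) N.≤_) lengths
                        (subst (N._≤ length v N.+ length y) (sym (NP.+-suc (length x) (length y)))
                               (NP.+-monoˡ-≤ (length y) x<v))
        longer : n N.≤ length x N.+ suc (length y)
        longer = subst (n N.≤_) (LP.length-++ x) (w-long (x ++ t ∷ y) xty~w)

      positive : ¬ ¬ Nonneg (actRoot A w (simpleRoot s))
      positive with DihedralLemma.dihedral-lemma (dihedral s s′ (λ e → s′≢s (sym e))) y y-in-pair y-reduced ys-long
      ... | P , Q , P≥0 , Q≥0 , yαs≈ =
        ih v-short v refl v-reduced s  (vt-long s  (inj₁ refl)) >>= λ vαs≥0 →
        ih v-short v refl v-reduced s′ (vt-long s′ (inj₂ refl)) >>= λ vαs′≥0 →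
        pure (Nonneg-≈ wαs≈ (Nonneg-comb vαs≥0 vαs′≥0 P≥0 Q≥0))
        where
        wαs≈ : actRoot A w (simpleRoot s) ≈ P ⊙ actRoot A v (simpleRoot s) ⊕ Q ⊙ actRoot A v (simpleRoot s′)
        wαs≈ = ≈-trans (≈-sym (same-action vy~w (simpleRoot s)))
              (≈-trans (act-++≈ v y (simpleRoot s))
              (≈-trans (act-cong v yαs≈)
              (≈-trans (act-⊕ v _ _)
                       (λ j → cong₂ _+_ (act-⊙ v P (simpleRoot s) j) (act-⊙ v Q (simpleRoot s′) j)))))

    positive : ¬ ¬ Nonneg (actRoot A w (simpleRoot s))
    positive = least Factorisation (length w′) trivial >>= λ where
      (_ , (v , y , refl , y-in-pair , vy~w , lengths) , shortest) →
        Shortest.positive v y y-in-pair vy~w lengths shortest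

  positivity : ∀ n → PositiveAt n
  positivity = <-rec PositiveAt step
    where
    step : ∀ n → (∀ {m} → m N.< n → PositiveAt m) → PositiveAt n
    step n ih w len reduced s ws-long with reverseView w
    ... | []            = pure (δ-nonneg s)
    ... | w′ ∶ _ ∶ʳ s′ with s′ F.≟ s
    ...   | no s′≢s = Step.positive n ih w′ s′ s s′≢s len reduced ws-long
    ...   | yes refl = ⊥-elim (NP.<⇒≱ w′<n (ws-long w′ (~-sym (cancel-last w′ s))))
      where
      w′<n : length w′ N.< n
      w′<n = subst (length w′ N.<_) (trans (NP.+-comm 1 (length w′)) (trans (sym (LP.length-++ w′)) len)) NP.≤-refl

  -- Take x ~ u reduced.
  -- If ℓ(x k) ≥ ℓ(x), positivity applies to x.  Otherwise some reduced
  -- z' with z' k ~ x is shorter than x, positivity applies to z', and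
  -- u α_k = z' s_k α_k = -z' α_k.
  sign-dichotomy : ∀ u k → ¬ ¬ (Nonneg (actRoot A u (simpleRoot k)) ⊎ Nonpos (actRoot A u (simpleRoot k)))
  sign-dichotomy u k = reduced-word u >>= λ where
    (x , x~u , x-reduced) → ¬¬-excluded-middle {A = LengthAtLeast (length x) (x ++ k ∷ [])} >>= λ where
      (yes xk-long) → positivity (length x) x refl x-reduced k xk-long >>= λ xαk≥0 →
        pure (inj₁ (Nonneg-≈ (≈-sym (same-action x~u (simpleRoot k))) xαk≥0))
      (no ¬xk-long) → shorter-word ¬xk-long >>= λ where
        (z , z~xk , z<x) → reduced-word z >>= λ where
          (z′ , z′~z , z′-reduced) →
            let z′k~x : z′ ++ k ∷ [] ~ x
                z′k~x = ~-trans (~-++ʳ (k ∷ []) (~-trans z′~z z~xk)) (cancel-last x k)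
                z′k-long : LengthAtLeast (length z′) (z′ ++ k ∷ [])
                z′k-long t t~z′k = NP.≤-trans (z′-reduced z (~-sym z′~z))
                                     (NP.≤-trans (NP.<⇒≤ z<x) (x-reduced t (~-trans t~z′k z′k~x)))
                uαk≈ : actRoot A u (simpleRoot k) ≈ neg (actRoot A z′ (simpleRoot k))
                uαk≈ = ≈-trans (≈-sym (same-action (~-trans z′k~x x~u) (simpleRoot k)))
                               (act-snoc-simple A-diag z′ k)
            in positivity (length z′) z′ refl z′-reduced k z′k-long >>= λ z′αk≥0 →
               pure (inj₂ λ j → subst (_≤ + 0) (sym (uαk≈ j)) (ZP.neg-mono-≤ (z′αk≥0 j)))

congruent-in-range : ∀ (t x y : ℤ) → + 1 ≤ x → x ≤ t → + 1 ≤ y → y ≤ t →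
                     (+ 1 + t) DS.∣ (x - y) → x ≡ y
congruent-in-range t x y 1≤x x≤t 1≤y y≤t (divides q x-y≡) = from-quotient q x-y≡
  where
  upper : x - y ≤ t - + 1
  upper = ZP.+-mono-≤ x≤t (ZP.neg-mono-≤ 1≤y)
  lower : + 1 - t ≤ x - y
  lower = ZP.+-mono-≤ 1≤x (ZP.neg-mono-≤ y≤t)
  h≥0 : + 0 ≤ + 1 + t
  h≥0 = ZP.+-mono-≤ (+≤+ N.z≤n) (ZP.≤-trans (+≤+ N.z≤n) (ZP.≤-trans 1≤x x≤t))
  from-quotient : ∀ q → x - y ≡ q * (+ 1 + t) → x ≡ y
  from-quotient (+ 0) x-y≡ = ZP.i-j≡0⇒i≡j x y (trans x-y≡ (ZP.*-zeroˡ (+ 1 + t)))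
  from-quotient (+ suc n) x-y≡ = ⊥-elim (ZP.<⇒≱ too-big (subst (_≤ t - + 1) x-y≡ upper))
    where
    -- (1 + n)(1 + t) ≥ 1 + t > t - 1.
    too-big : t - + 1 < (+ 1 + + n) * (+ 1 + t)
    too-big = subst₂ _<_ (shift t) (sym (expand (+ n) t))
                (ZP.+-mono-<-≤ (ZP.+-monoˡ-< t (Z.-<+ {0} {1})) (*-nonneg {+ n} (+≤+ N.z≤n) h≥0))
      where
      shift : ∀ t → - + 1 + t + + 0 ≡ t - + 1
      shift = solve-∀
      expand : ∀ n t → (+ 1 + n) * (+ 1 + t) ≡ + 1 + t + n * (+ 1 + t)
      expand = solve-∀
  from-quotient -[1+ n ] x-y≡ = ⊥-elim (ZP.<⇒≱ too-small (subst (+ 1 - t ≤_) x-y≡ lower))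
    where
    -- -(1 + n)(1 + t) ≤ -(1 + t) < 1 - t.
    too-small : - (+ 1 + + n) * (+ 1 + t) < + 1 - t
    too-small = subst₂ _<_ (sym (expand (+ n) t)) (ZP.+-identityˡ _)
                  (ZP.+-mono-≤-< (ZP.neg-mono-≤ (*-nonneg {+ n} (+≤+ N.z≤n) h≥0))
                                 (ZP.+-monoˡ-< (- t) (Z.-<+ {0} {1})))
      where
      expand : ∀ n t → - (+ 1 + n) * (+ 1 + t) ≡ - (n * (+ 1 + t)) + (- + 1 - t)
      expand = solve-∀

*-cancel-1+ˡ : ∀ t → + 0 ≤ t → ∀ x y → (+ 1 + t) * x ≡ (+ 1 + t) * y → x ≡ y
*-cancel-1+ˡ (+ n) _ x y e = ZP.*-cancelˡ-≡ (+ suc n) x y e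

positive⇒≥1 : ∀ {x} → + 0 < x → + 1 ≤ x
positive⇒≥1 {+ suc n} (Z.+<+ (N.s≤s _)) = +≤+ (N.s≤s N.z≤n)

negative⇒≤-1 : ∀ {x} → x < + 0 → x ≤ -[1+ 0 ]
negative⇒≤-1 { -[1+ n ]} _          = -≤- N.z≤n
negative⇒≤-1 {+ n}       (Z.+<+ ())

-- Duality between the coweight and root lattices: with the pairing
-- ⟨λ, v⟩ = Σ_j λ_j v_j (recall (ω_i, α_j) = δ_ij), W acts adjointly.

pairing : ∀ {r} → Vector r → Vector r → ℤ
pairing {r} l v = sumFin r (λ j → l j * v j)

module Duality {r : ℕ} (A : CartanMatrix r) where
  open Reflections A

  actCoweight-++ : ∀ x y l → actCoweight A (x ++ y) l ≡ actCoweight A x (actCoweight A y l)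
  actCoweight-++ []      y l = refl
  actCoweight-++ (i ∷ x) y l = cong (reflCoweight A i) (actCoweight-++ x y l)

  -- ⟨λ, s_i v⟩ = ⟨s_i λ, v⟩: both equal ⟨λ, v⟩ - λ_i ⟨α_i^∨, v⟩.
  refl-adjoint : ∀ i l v → pairing l (reflRoot A i v) ≡ pairing (reflCoweight A i l) v
  refl-adjoint i l v = trans root-side (sym coweight-side)
    where
    root-side : pairing l (reflRoot A i v) ≡ pairing l v - l i * coroot i v
    root-side =
      trans (sum-cong (λ j → distrib (l j) (v j) (coroot i v) (simpleRoot i j)))
     (trans (sum-- (λ j → l j * v j) (λ j → l j * coroot i v * simpleRoot i j))
            (cong (_-_ (pairing l v)) (sum-δ i (λ j → l j * coroot i v))))
      where
      distrib : ∀ l v c δ → l * (v - c * δ) ≡ l * v - l * c * δ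
      distrib = solve-∀
    coweight-side : pairing (reflCoweight A i l) v ≡ pairing l v - l i * coroot i v
    coweight-side =
      trans (sum-cong (λ j → distrib (l j) (l i) (A i j) (v j)))
     (trans (sum-- (λ j → l j * v j) (λ j → l i * (A i j * v j)))
            (cong (_-_ (pairing l v)) (sum-*ˡ (l i) (λ j → A i j * v j))))
      where
      distrib : ∀ lj li a v → (lj - li * a) * v ≡ lj * v - li * (a * v)
      distrib = solve-∀

  act-adjoint : ∀ x l v → pairing l (actRoot A x v) ≡ pairing (actCoweight A (reverse x) l) v
  act-adjoint []      l v = refl
  act-adjoint (i ∷ x) l v =
    trans (refl-adjoint i l (actRoot A x v))
   (trans (act-adjoint x (reflCoweight A i l) v)
          (cong (λ μ → pairing μ v) (sym reverse-cons)))
    where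
    reverse-cons : actCoweight A (reverse (i ∷ x)) l ≡ actCoweight A (reverse x) (reflCoweight A i l)
    reverse-cons = trans (cong (λ z → actCoweight A z l) (LP.unfold-reverse i x))
                         (actCoweight-++ (reverse x) (i ∷ []) l)

module Residue {r : ℕ} (A : CartanMatrix r) (gcm : IsGCM A) (ft : IsFiniteType A)
               (θ : Fin r → ℤ) (highest : IsHighestRoot A θ) where
  open Reflections A
  open FiniteType A gcm ft using (A-diag; dihedral-data)
  open Positivity A A-diag dihedral-data using (sign-dichotomy)
  open Duality A

  below-θ : ∀ β → IsRoot A β → ∀ j → β j ≤ θ j
  below-θ = proj₂ highest

  simple-root : ∀ i → IsRoot A (simpleRoot i)
  simple-root i = [] , i , λ _ → refl

  root-act : ∀ x v → IsRoot A v → IsRoot A (actRoot A x v)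
  root-act x v (w , i , v≈) = x ++ w , i , ≈-trans (act-cong x v≈) (≈-sym (act-++≈ x w (simpleRoot i)))

  root-neg : ∀ v → IsRoot A v → IsRoot A (neg v)
  root-neg v (w , i , v≈) = w ++ i ∷ [] , i , λ j → trans (cong -_ (v≈ j)) (sym (act-snoc-simple A-diag w i j))

  act-reverse : ∀ w u → actRoot A (reverse w) (actRoot A w u) ≈ u
  act-reverse []      u = ≈-refl
  act-reverse (i ∷ w) u rewrite LP.unfold-reverse i w =
    ≈-trans (act-++≈ (reverse w) (i ∷ []) _)
            (≈-trans (act-cong (reverse w) (refl-invol A-diag i (actRoot A w u))) (act-reverse w u))

  root-nonzero : ∀ v → IsRoot A v → Σ (Fin r) λ j → ¬ v j ≡ + 0
  root-nonzero v (w , i , v≈) = FP.¬∀⟶∃¬ r _ (λ j → v j Z.≟ + 0) λ v≈0 → 1≢0 (trans (sym (δ-diag i)) (αi≈0 v≈0 i))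
    where
    1≢0 : ¬ + 1 ≡ + 0
    1≢0 ()
    αi≈0 : v ≈ 0v → simpleRoot i ≈ 0v
    αi≈0 v≈0 = ≈-trans (≈-sym (act-reverse w (simpleRoot i)))
           (≈-trans (act-cong (reverse w) (≈-sym v≈))
           (≈-trans (act-cong (reverse w) v≈0) (act-0 (reverse w))))

  root-sign : ∀ v → IsRoot A v → ¬ ¬ (Nonneg v ⊎ Nonpos v)
  root-sign v (w , i , v≈) = sign-dichotomy w i >>= λ where
    (inj₁ ≥0) → pure (inj₁ (Nonneg-≈ v≈ ≥0))
    (inj₂ ≤0) → pure (inj₂ λ j → subst (_≤ + 0) (sym (v≈ j)) (≤0 j))

  -- t = Σ_j θ_j, so that h^∨ = 1 + t; ht(v) = Σ_j v_j.
  t : ℤ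
  t = sumFin r θ

  height : Vector r → ℤ
  height v = sumFin r v

  -- θ dominates every root, in particular α_j and -β.
  height≤t : ∀ v → IsRoot A v → height v ≤ t
  height≤t v v-root = sum-mono (below-θ v v-root)

  -t≤height : ∀ v → IsRoot A v → - t ≤ height v
  -t≤height v v-root = subst (_≤ height v) (sum-neg θ)
    (sum-mono (λ j → subst (- θ j ≤_) (ZP.neg-involutive (v j))
                           (ZP.neg-mono-≤ (below-θ (neg v) (root-neg v v-root) j))))

  t≥0 : + 0 ≤ t
  t≥0 = sum-nonneg (λ j → ZP.≤-trans (δ-nonneg j j) (below-θ (simpleRoot j) (simple-root j) j))

  residue : Vector r → ℤ
  residue v = hvee θ * bit (isNegative v) + height v

  isNegative-true : ∀ {v : Vector r} → Nonpos v → isNegative v ≡ true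
  isNegative-true {v} v≤0 = trans (isYes≗does (all? (λ j → v j Z.≤? + 0))) (dec-true (all? _) v≤0)

  isNegative-false : ∀ {v : Vector r} → ¬ Nonpos v → isNegative v ≡ false
  isNegative-false {v} v≰0 = trans (isYes≗does (all? (λ j → v j Z.≤? + 0))) (dec-false (all? _) v≰0)

  positive-residue : ∀ v → IsRoot A v → Nonneg v → + 1 ≤ residue v × residue v ≤ t
  positive-residue v v-root v≥0 = subst (λ z → + 1 ≤ z × z ≤ t) (sym residue≡)
      (positive⇒≥1 (sum-pos v≥0 j (ZP.≤∧≢⇒< (v≥0 j) (λ e → vj≢0 (sym e)))) , height≤t v v-root)
    where
    j = proj₁ (root-nonzero v v-root)
    vj≢0 = proj₂ (root-nonzero v v-root)
    residue≡ : residue v ≡ height v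
    residue≡ rewrite isNegative-false {v} (λ v≤0 → vj≢0 (ZP.≤-antisym (v≤0 j) (v≥0 j))) =
      trans (cong (_+ height v) (ZP.*-zeroʳ (hvee θ))) (ZP.+-identityˡ (height v))

  negative-residue : ∀ v → IsRoot A v → Nonpos v → + 1 ≤ residue v × residue v ≤ t
  negative-residue v v-root v≤0 = subst (λ z → + 1 ≤ z × z ≤ t) (sym residue≡)
      (subst (_≤ hvee θ + height v) (cancel t) (ZP.+-monoʳ-≤ (hvee θ) (-t≤height v v-root)) ,
       subst (hvee θ + height v ≤_) (cancel-1 t) (ZP.+-monoʳ-≤ (hvee θ) (negative⇒≤-1 height<0)))
    where
    j = proj₁ (root-nonzero v v-root)
    vj≢0 = proj₂ (root-nonzero v v-root)
    residue≡ : residue v ≡ hvee θ + height v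
    residue≡ rewrite isNegative-true v≤0 = cong (_+ height v) (ZP.*-identityʳ (hvee θ))
    cancel : ∀ t → + 1 + t + - t ≡ + 1
    cancel = solve-∀
    cancel-1 : ∀ t → + 1 + t + -[1+ 0 ] ≡ t
    cancel-1 = solve-∀
    -v≥0 : Nonneg (neg v)
    -v≥0 j = ZP.neg-mono-≤ (v≤0 j)
    height<0 : height v < + 0
    height<0 = subst (_< + 0) (ZP.neg-involutive (height v)) (ZP.neg-mono-<
      (subst (+ 0 <_) (sum-neg v)
        (sum-pos -v≥0 j (ZP.≤∧≢⇒< (-v≥0 j) λ e → vj≢0 (trans (sym (ZP.neg-involutive (v j))) (cong -_ (sym e)))))))

  -- Every root has residue in {1, …, t}.  The statement is decidable, so
  -- the classical sign dichotomy may be used.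
  residue-range : ∀ v → IsRoot A v → + 1 ≤ residue v × residue v ≤ t
  residue-range v v-root = decidable-stable (+ 1 Z.≤? residue v ×-dec residue v Z.≤? t)
    (root-sign v v-root >>= λ where
      (inj₁ v≥0) → pure (positive-residue v v-root v≥0)
      (inj₂ v≤0) → pure (negative-residue v v-root v≤0))

  height-pairing : ∀ v → height v ≡ pairing ρ v
  height-pairing v = sum-cong (λ j → sym (ZP.*-identityˡ (v j)))

  -- For c ∈ C: ht(c⁻¹ v) - ht(v) = ⟨c ρ - ρ, v⟩ ∈ h^∨ ℤ.
  height-shift : ∀ c → InC A θ c → ∀ v → hvee θ DS.∣ (height (actRoot A (reverse c) v) - height v)
  height-shift c c∈C v = subst (hvee θ DS.∣_) (sym difference)
    (sum-∣ (λ j → DS.∣m⇒∣m*n {m = actCoweight A c ρ j - ρ j} (v j) (DS.∣ᵤ⇒∣ (c∈C j))))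
    where
    difference : height (actRoot A (reverse c) v) - height v
                 ≡ sumFin r (λ j → (actCoweight A c ρ j - ρ j) * v j)
    difference =
      trans (cong₂ _-_ (trans (height-pairing _)
                       (trans (act-adjoint (reverse c) ρ v)
                              (cong (λ z → pairing (actCoweight A z ρ) v) (LP.reverse-involutive c))))
                       (height-pairing v))
     (trans (sym (sum-- (λ j → actCoweight A c ρ j * v j) (λ j → ρ j * v j)))
            (sum-cong (λ j → factor (actCoweight A c ρ j) (ρ j) (v j))))
      where
      factor : ∀ a b v → a * v - b * v ≡ (a - b) * v
      factor = solve-∀

  -- Hence R(c⁻¹ v) ≡ R(v) mod h^∨, and both lie in {1, …, t}.
  residue-invariant : ∀ c → InC A θ c → ∀ v → IsRoot A v → residue (actRoot A (reverse c) v) ≡ residue v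
  residue-invariant c c∈C v v-root =
    congruent-in-range t (residue v′) (residue v)
      (proj₁ (residue-range v′ (root-act (reverse c) v v-root))) (proj₂ (residue-range v′ (root-act (reverse c) v v-root)))
      (proj₁ (residue-range v v-root)) (proj₂ (residue-range v v-root))
      (subst (hvee θ DS.∣_) (sym (regroup (hvee θ) (bit (isNegative v′)) (bit (isNegative v)) (height v′) (height v)))
             (DS.∣m∣n⇒∣m+n (DS.∣m⇒∣m*n (bit (isNegative v′) - bit (isNegative v)) (DS.∣-refl {hvee θ}))
                           (height-shift c c∈C v)))
    where
    v′ : Vector r
    v′ = actRoot A (reverse c) v
    regroup : ∀ h b′ b x′ x → h * b′ + x′ - (h * b + x) ≡ h * (b′ - b) + (x′ - x)
    regroup = solve-∀

  -- α₀ + Σ_i a_i α_i = 0 with α₀ = -θ, so the heights of x α₀, …, x α_r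
  -- weighted by a₀ = 1, a_i = θ_i sum to 0 (all are ⟨x⁻¹ ρ, -⟩).
  affine-relation : ∀ x → height (actRoot A x (λ j → - θ j))
                          + sumFin r (λ i → θ i * height (actRoot A x (simpleRoot i))) ≡ + 0
  affine-relation x =
    trans (cong₂ _+_ height₀ (sum-cong heightᵢ))
   (trans (cong (_+_ (- sumFin r (λ j → μ j * θ j))) (sum-cong (λ i → ZP.*-comm (θ i) (μ i))))
          (ZP.+-inverseˡ (sumFin r (λ j → μ j * θ j))))
    where
    μ : Vector r
    μ = actCoweight A (reverse x) ρ
    height₀ : height (actRoot A x (λ j → - θ j)) ≡ - sumFin r (λ j → μ j * θ j)
    height₀ = trans (height-pairing _) (trans (act-adjoint x ρ (λ j → - θ j))
              (trans (sum-cong (λ j → sym (ZP.neg-distribʳ-* (μ j) (θ j)))) (sum-neg (λ j → μ j * θ j))))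
    heightᵢ : ∀ i → θ i * height (actRoot A x (simpleRoot i)) ≡ θ i * μ i
    heightᵢ i = cong (θ i *_) (trans (height-pairing _) (trans (act-adjoint x ρ (simpleRoot i)) (sum-δ i μ)))

  -- h^∨ cdes(x) = Σ_{i=0}^r a_i R(x α_i): the height parts cancel.
  cdes-residues : ∀ x → hvee θ * cdes A θ x
                        ≡ residue (actRoot A x (λ j → - θ j)) + sumFin r (λ i → θ i * residue (actRoot A x (simpleRoot i)))
  cdes-residues x =
    trans (regroup (hvee θ) (d₀ A θ x) (sumFin r (λ i → θ i * d A x i)) height₀ (sumFin r (λ i → θ i * heightᵢ i)))
   (trans (cong₂ (λ u z → residue (actRoot A x (λ j → - θ j)) + u - z) (sym residues) (affine-relation x))
          (ZP.+-identityʳ _))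
    where
    height₀ : ℤ
    height₀ = height (actRoot A x (λ j → - θ j))
    heightᵢ : Fin r → ℤ
    heightᵢ i = height (actRoot A x (simpleRoot i))
    residues : sumFin r (λ i → θ i * residue (actRoot A x (simpleRoot i)))
               ≡ hvee θ * sumFin r (λ i → θ i * d A x i) + sumFin r (λ i → θ i * heightᵢ i)
    residues = trans (sum-cong (λ i → distrib (θ i) (hvee θ) (d A x i) (heightᵢ i)))
              (trans (sum-+ (λ i → hvee θ * (θ i * d A x i)) (λ i → θ i * heightᵢ i))
                     (cong (_+ sumFin r (λ i → θ i * heightᵢ i)) (sum-*ˡ (hvee θ) (λ i → θ i * d A x i))))
      where
      distrib : ∀ θ h b x → θ * (h * b + x) ≡ h * (θ * b) + θ * x
      distrib = solve-∀
    regroup : ∀ h b₀ B x₀ X → h * (+ 1 * b₀ + B) ≡ h * b₀ + x₀ + (h * B + X) - (x₀ + X)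
    regroup = solve-∀

  cdes-coset : ∀ w c → InC A θ c → cdes A θ (reverse c ++ reverse w) ≡ cdes A θ (reverse w)
  cdes-coset w c c∈C = *-cancel-1+ˡ t t≥0 _ _ (begin
    hvee θ * cdes A θ (reverse c ++ reverse w)
      ≡⟨ cdes-residues (reverse c ++ reverse w) ⟩
    residue (actRoot A (reverse c ++ w⁻¹) (λ j → - θ j))
      + sumFin r (λ i → θ i * residue (actRoot A (reverse c ++ w⁻¹) (simpleRoot i)))
      ≡⟨ cong₂ _+_ (invariant (λ j → - θ j) (root-neg θ (proj₁ highest)))
                   (sum-cong (λ i → cong (θ i *_) (invariant (simpleRoot i) (simple-root i)))) ⟩
    residue (actRoot A w⁻¹ (λ j → - θ j)) + sumFin r (λ i → θ i * residue (actRoot A w⁻¹ (simpleRoot i)))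
      ≡⟨ cdes-residues w⁻¹ ⟨
    hvee θ * cdes A θ w⁻¹ ∎)
    where
    open ≡-Reasoning
    w⁻¹ : Word r
    w⁻¹ = reverse w
    invariant : ∀ v → IsRoot A v → residue (actRoot A (reverse c ++ w⁻¹) v) ≡ residue (actRoot A w⁻¹ v)
    invariant v v-root = trans (cong residue (act-++ (reverse c) w⁻¹ v))
                               (residue-invariant c c∈C (actRoot A w⁻¹ v) (root-act w⁻¹ v v-root))

mainTheorem18 : {r : ℕ} (A : CartanMatrix r) → IsIrreducibleRootSystem A →
    (θ : Fin r → ℤ) → IsHighestRoot A θ →
    (w c : Word r) → InC A θ c →
    cdes A θ (reverse (w ++ c)) ≡ cdes A θ (reverse w)
mainTheorem18 A (gcm , _ , ft) θ highest w c c∈C =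
  trans (cong (cdes A θ) (LP.reverse-++ w c)) (Residue.cdes-coset A gcm ft θ highest w c c∈C)
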